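{- Let $S$ be a minimal separator in a permutation graph $G$ and let $C$ be a connected component of $G-S$. If $\tau,\upsilon\in S$ are nonadjacent, then $N(\tau)\cap C\subseteq N(\upsilon)\cap C$ or $N(\upsilon)\cap C\subseteq N(\tau)\cap C$.
   Context: A permutation graph is a graph whose vertices correspond to $n$ line segments joining points labeled $1,\dots,n$ on a horizontal top line to the equally labeled points on a parallel bottom line, two vertices being adjacent iff their segments intersect. A minimal separator is a vertex set $S$ that, for some nonadjacent vertices $a,b$, separates $a$ and $b$ (they lie in different components of $G-S$) and is inclusion-minimal with this property. -}

module Defs where

open import Data.Nat using (ℕ)
open import Data.Fin using (Fin; _<_)
open import Data.Fin.Subset using (Subset; _∈_; _∉_; _⊆_; _⊂_)
open import Data.Product using (_×_; ∃; Σ)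
open import Data.Sum using (_⊎_)
open import Data.Empty using (⊥)
open import Relation.Nullary using (¬_)
open import Data.Fin.Permutation using (Permutation; _⟨$⟩ʳ_)
open import Relation.Binary.PropositionalEquality using (_≡_)

-- The permutation graph of a permutation π of {0..n-1}: segment i joins
-- position i on the top line to position π(i) on the bottom line.
-- Two segments cross iff their relative order is reversed.
Adj : ∀ {n} → Permutation n n → Fin n → Fin n → Set
Adj π i j = (i < j × π ⟨$⟩ʳ j < π ⟨$⟩ʳ i) ⊎ (j < i × π ⟨$⟩ʳ i < π ⟨$⟩ʳ j)

data Reach {n} (π : Permutation n n) (S : Subset n) : Fin n → Fin n → Set where
  here : ∀ {a} → a ∉ S → Reach π S a a
  step : ∀ {a b c} → a ∉ S → Adj π a b → Reach π S b c → Reach π S a c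

Separates : ∀ {n} → Permutation n n → Subset n → Fin n → Fin n → Set
Separates π S a b = a ∉ S × b ∉ S × ¬ Reach π S a b

MinimalSeparator : ∀ {n} → Permutation n n → Subset n → Set
MinimalSeparator {n} π S =
  ∃ λ a → ∃ λ b → ¬ (a ≡ b) × ¬ Adj π a b × Separates π S a b
    × (∀ (S' : Subset n) → S' ⊂ S → ¬ Separates π S' a b)

IsComponent : ∀ {n} → Permutation n n → Subset n → Subset n → Set
IsComponent π S C =
    (∃ λ x → x ∈ C)
  × (∀ {x} → x ∈ C → x ∉ S)
  × (∀ {x y} → x ∈ C → y ∈ C → Reach π S x y)
  × (∀ {x y} → x ∈ C → Reach π S x y → y ∈ C)

NbhdIncl : ∀ {n} → Permutation n n → Subset n → Fin n → Fin n → Set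
NbhdIncl π C t u = ∀ {x} → x ∈ C → Adj π t x → Adj π u x

-- Two nonadjacent segments τ, υ are comparable: say τ lies entirely to the left of υ.
-- If the component C held both a neighbour x of τ but not of υ and a neighbour y of υ
-- but not of τ, then C would stretch from the left of υ to the right of τ. A minimal
-- separator has a second full component D ≠ C, which touches both τ and υ; since a
-- component lies entirely on one side of every segment outside it, D must lie left of
-- y, hence left of x, hence left of υ, contradicting that D touches υ.
module Submission where

open import Defs
open import Data.Fin using (Fin; _<_; _<?_)
open import Data.Fin.Properties using (<-cmp; <-trans; <-asym; all?) renaming (_≟_ to _≟ᶠ_)
open import Data.Fin.Subset using (Subset; _∈_; _∉_; _⊂_; _-_; ⁅_⁆)
open import Data.Fin.Subset.Properties using (_∈?_; p─q⊆p; x∈p⇒p-x⊂p; x∈p∧x≢y⇒x∈p-y)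
open import Data.Fin.Permutation using (Permutation; _⟨$⟩ʳ_; _⟨$⟩ˡ_; inverseˡ)
open import Data.Product using (_×_; _,_; ∃; proj₂)
open import Data.Sum using (_⊎_; inj₁; inj₂)
open import Data.Empty using (⊥; ⊥-elim)
open import Effect.Monad using (RawMonad)
open import Function using (_∘_; id)
open import Relation.Binary.Definitions using (Decidable; tri<; tri≈; tri>)
open import Relation.Binary.PropositionalEquality using (_≡_; _≢_; refl; cong; module ≡-Reasoning)
open import Relation.Nullary using (¬_; Dec; yes; no)
open import Relation.Nullary.Decidable using (_×-dec_; _⊎-dec_; _→-dec_; map′; decidable-stable)
open import Relation.Nullary.Negation using (¬¬-Monad)

module PermutationGraph {n} (π : Permutation n n) where

  infix 4 _≺_

  _≺_ : Fin n → Fin n → Set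
  i ≺ j = i < j × π ⟨$⟩ʳ i < π ⟨$⟩ʳ j

  ≺-trans : ∀ {i j k} → i ≺ j → j ≺ k → i ≺ k
  ≺-trans (i<j , πi<πj) (j<k , πj<πk) = <-trans i<j j<k , <-trans πi<πj πj<πk

  Adj-sym : ∀ {i j} → Adj π i j → Adj π j i
  Adj-sym (inj₁ crossing) = inj₂ crossing
  Adj-sym (inj₂ crossing) = inj₁ crossing

  Adj? : Decidable (Adj π)
  Adj? i j = (i <? j ×-dec π ⟨$⟩ʳ j <? π ⟨$⟩ʳ i) ⊎-dec (j <? i ×-dec π ⟨$⟩ʳ i <? π ⟨$⟩ʳ j)

  ≺⇒¬Adj : ∀ {i j} → i ≺ j → ¬ Adj π i j
  ≺⇒¬Adj (_ , πi<πj) (inj₁ (_ , πj<πi)) = <-asym πi<πj πj<πi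
  ≺⇒¬Adj (i<j , _) (inj₂ (j<i , _)) = <-asym i<j j<i

  ≺⇒¬Adjˡ : ∀ {i j} → i ≺ j → ¬ Adj π j i
  ≺⇒¬Adjˡ i≺j = ≺⇒¬Adj i≺j ∘ Adj-sym

  π-injective : ∀ {i j} → π ⟨$⟩ʳ i ≡ π ⟨$⟩ʳ j → i ≡ j
  π-injective {i} {j} πi≡πj = begin
    i                        ≡⟨ inverseˡ π ⟨
    π ⟨$⟩ˡ (π ⟨$⟩ʳ i)        ≡⟨ cong (π ⟨$⟩ˡ_) πi≡πj ⟩
    π ⟨$⟩ˡ (π ⟨$⟩ʳ j)        ≡⟨ inverseˡ π ⟩
    j                        ∎
    where open ≡-Reasoning

  ¬Adj⇒≺⊎≻ : ∀ {i j} → i ≢ j → ¬ Adj π i j → i ≺ j ⊎ j ≺ i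
  ¬Adj⇒≺⊎≻ {i} {j} i≢j i≁j with <-cmp i j | <-cmp (π ⟨$⟩ʳ i) (π ⟨$⟩ʳ j)
  ... | tri≈ _ i≡j _ | _                = ⊥-elim (i≢j i≡j)
  ... | _            | tri≈ _ πi≡πj _   = ⊥-elim (i≢j (π-injective πi≡πj))
  ... | tri< i<j _ _ | tri< πi<πj _ _   = inj₁ (i<j , πi<πj)
  ... | tri< i<j _ _ | tri> _ _ πj<πi   = ⊥-elim (i≁j (inj₁ (i<j , πj<πi)))
  ... | tri> _ _ j<i | tri< πi<πj _ _   = ⊥-elim (i≁j (inj₂ (j<i , πi<πj)))
  ... | tri> _ _ j<i | tri> _ _ πj<πi   = inj₂ (j<i , πj<πi)

  PrivateNeighbour : Fin n → Fin n → Fin n → Set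
  PrivateNeighbour t u x = Adj π t x × ¬ Adj π u x

  ¬NbhdIncl⇒privateNeighbour : ∀ {C t u} → ¬ NbhdIncl π C t u →
                               ¬ ¬ (∃ λ x → x ∈ C × PrivateNeighbour t u x)
  ¬NbhdIncl⇒privateNeighbour {u = u} t⊈u ¬private = t⊈u λ {x} x∈C tx →
    decidable-stable (Adj? u x) (λ ¬ux → ¬private (x , x∈C , tx , ¬ux))

  NbhdIncl? : ∀ C t u → Dec (NbhdIncl π C t u)
  NbhdIncl? C t u = map′ (λ incl {x} → incl x) (λ incl x → incl {x})
    (all? λ x → x ∈? C →-dec (Adj? t x →-dec Adj? u x))

  module _ {S : Subset n} where

    Reach-start∉ : ∀ {a b} → Reach π S a b → a ∉ S
    Reach-start∉ (here a∉S)     = a∉S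
    Reach-start∉ (step a∉S _ _) = a∉S

    Reach-end∉ : ∀ {a b} → Reach π S a b → b ∉ S
    Reach-end∉ (here b∉S)   = b∉S
    Reach-end∉ (step _ _ r) = Reach-end∉ r

    Reach-trans : ∀ {a b c} → Reach π S a b → Reach π S b c → Reach π S a c
    Reach-trans (here _)         r = r
    Reach-trans (step a∉S ab q) r = step a∉S ab (Reach-trans q r)

    Reach-sym : ∀ {a b} → Reach π S a b → Reach π S b a
    Reach-sym (here a∉S)         = here a∉S
    Reach-sym (step a∉S ab r) =
      Reach-trans (Reach-sym r) (step (Reach-start∉ r) (Adj-sym ab) (here a∉S))

    unreachable⇒≺⊎≻ : ∀ {c z} → c ∉ S → z ∉ S → ¬ Reach π S c z → z ≺ c ⊎ c ≺ z
    unreachable⇒≺⊎≻ c∉S z∉S c↛z =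
      ¬Adj⇒≺⊎≻ (λ { refl → c↛z (here c∉S) }) (λ zc → c↛z (step c∉S (Adj-sym zc) (here z∉S)))

    -- A walk cannot jump over a segment z it does not reach, so a whole
    -- component of G - S lies on one side of z.
    ≻-along : ∀ {c d z} → Reach π S c d → z ∉ S → ¬ Reach π S c z → z ≺ c → z ≺ d
    ≻-along (here _) _ _ z≺c = z≺c
    ≻-along (step c∉S cw w↝d) z∉S c↛z z≺c
      with unreachable⇒≺⊎≻ (Reach-start∉ w↝d) z∉S (c↛z ∘ step c∉S cw)
    ... | inj₁ z≺w = ≻-along w↝d z∉S (c↛z ∘ step c∉S cw) z≺w
    ... | inj₂ w≺z = ⊥-elim (≺⇒¬Adjˡ (≺-trans w≺z z≺c) cw)

    ≺-along : ∀ {c d z} → Reach π S c d → z ∉ S → ¬ Reach π S c z → c ≺ z → d ≺ z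
    ≺-along (here _) _ _ c≺z = c≺z
    ≺-along (step c∉S cw w↝d) z∉S c↛z c≺z
      with unreachable⇒≺⊎≻ (Reach-start∉ w↝d) z∉S (c↛z ∘ step c∉S cw)
    ... | inj₁ z≺w = ⊥-elim (≺⇒¬Adj (≺-trans c≺z z≺w) cw)
    ... | inj₂ w≺z = ≺-along w↝d z∉S (c↛z ∘ step c∉S cw) w≺z

  Touches : Subset n → Fin n → Fin n → Set
  Touches S d s = ∃ λ p → Reach π S d p × Adj π p s

  -- Doubly negated because reachability is not decided here.
  Full : Subset n → Fin n → Set
  Full S d = ∀ {s} → s ∈ S → ¬ ¬ Touches S d s

  module _ {S : Subset n} where

    ≺-privateNeighbours-⊥ : ∀ {τ υ x y d} → τ ≺ υ →
      PrivateNeighbour τ υ x → PrivateNeighbour υ τ y → Reach π S x y →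
      ¬ Reach π S x d → Touches S d τ → Touches S d υ → ⊥
    ≺-privateNeighbours-⊥ {τ} {υ} {x} {y} τ≺υ (τx , ¬υx) (υy , ¬τy) x↝y x↛d
      (q₁ , d↝q₁ , q₁τ) (q₂ , d↝q₂ , q₂υ) = ≺⇒¬Adj q₂≺υ q₂υ
      where
        x≺υ : x ≺ υ
        x≺υ with ¬Adj⇒≺⊎≻ (λ { refl → ≺⇒¬Adj τ≺υ τx }) (¬υx ∘ Adj-sym)
        ... | inj₁ x≺υ = x≺υ
        ... | inj₂ υ≺x = ⊥-elim (≺⇒¬Adj (≺-trans τ≺υ υ≺x) τx)

        τ≺y : τ ≺ y
        τ≺y with ¬Adj⇒≺⊎≻ (λ { refl → ≺⇒¬Adjˡ τ≺υ υy }) ¬τy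
        ... | inj₁ τ≺y = τ≺y
        ... | inj₂ y≺τ = ⊥-elim (≺⇒¬Adjˡ (≺-trans y≺τ τ≺υ) υy)

        y↛q₁ : ¬ Reach π S y q₁
        y↛q₁ y↝q₁ = x↛d (Reach-trans x↝y (Reach-trans y↝q₁ (Reach-sym d↝q₁)))

        q₁≺y : q₁ ≺ y
        q₁≺y with unreachable⇒≺⊎≻ (Reach-end∉ x↝y) (Reach-end∉ d↝q₁) y↛q₁
        ... | inj₁ q₁≺y = q₁≺y
        ... | inj₂ y≺q₁ = ⊥-elim (≺⇒¬Adjˡ (≺-trans τ≺y y≺q₁) q₁τ)

        q₂≺y : q₂ ≺ y
        q₂≺y = ≺-along (Reach-trans (Reach-sym d↝q₁) d↝q₂) (Reach-end∉ x↝y) (y↛q₁ ∘ Reach-sym) q₁≺y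

        q₂≺x : q₂ ≺ x
        q₂≺x = ≻-along (Reach-sym x↝y) (Reach-end∉ d↝q₂)
          (λ y↝q₂ → y↛q₁ (Reach-trans y↝q₂ (Reach-trans (Reach-sym d↝q₂) d↝q₁))) q₂≺y

        q₂≺υ : q₂ ≺ υ
        q₂≺υ = ≺-trans q₂≺x x≺υ

    privateNeighbours-⊥ : ∀ {τ υ x y d} → ¬ Adj π τ υ →
      PrivateNeighbour τ υ x → PrivateNeighbour υ τ y → Reach π S x y →
      ¬ Reach π S x d → Touches S d τ → Touches S d υ → ⊥
    privateNeighbours-⊥ τ≁υ x-private@(τx , ¬υx) y-private x↝y x↛d dτ dυ
      with ¬Adj⇒≺⊎≻ (λ { refl → ¬υx τx }) τ≁υ
    ... | inj₁ τ≺υ = ≺-privateNeighbours-⊥ τ≺υ x-private y-private x↝y x↛d dτ dυ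
    ... | inj₂ υ≺τ = ≺-privateNeighbours-⊥ υ≺τ y-private x-private (Reach-sym x↝y)
                       (x↛d ∘ Reach-trans x↝y) dυ dτ

    Reach-without⇒Touches : ∀ {s v b} → Reach π (S - s) v b → v ∉ S → ¬ Reach π S v b →
                            Touches S v s
    Reach-without⇒Touches (here _) v∉S v↛b = ⊥-elim (v↛b (here v∉S))
    Reach-without⇒Touches {s} (step {b = w} _ vw w↝b) v∉S v↛b with w ≟ᶠ s
    ... | yes refl = _ , here v∉S , vw
    ... | no w≢s
      with Reach-without⇒Touches w↝b (λ w∈S → Reach-start∉ w↝b (x∈p∧x≢y⇒x∈p-y w∈S w≢s))
                                     (v↛b ∘ step v∉S vw)
    ...   | p , w↝p , ps = p , step v∉S vw w↝p , ps

    Separates-sym : ∀ {S′ a b} → Separates π S′ a b → Separates π S′ b a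
    Separates-sym (a∉S , b∉S , a↛b) = b∉S , a∉S , a↛b ∘ Reach-sym

    minimal⇒Full : ∀ {a b} → Separates π S a b →
                   (∀ S′ → S′ ⊂ S → ¬ Separates π S′ a b) → Full S a
    minimal⇒Full (a∉S , b∉S , a↛b) minimal {s} s∈S ¬touches =
      minimal (S - s) (x∈p⇒p-x⊂p s∈S)
        (a∉S ∘ p─q⊆p S ⁅ s ⁆ , b∉S ∘ p─q⊆p S ⁅ s ⁆ ,
         λ a↝b → ¬touches (Reach-without⇒Touches a↝b a∉S a↛b))

    -- One of the two separated vertices a, b is not reachable from x.
    minimalSeparator⇒fullComponentAvoiding : MinimalSeparator π S → ∀ x →
      ¬ ¬ (∃ λ d → ¬ Reach π S x d × Full S d)
    minimalSeparator⇒fullComponentAvoiding (a , b , _ , _ , a∣b , minimal) x ¬avoiding =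
      ¬avoiding (a , (λ x↝a → ¬avoiding (b , x↛b x↝a , b-full)) , a-full)
      where
        a-full : Full S a
        a-full = minimal⇒Full a∣b minimal

        b-full : Full S b
        b-full = minimal⇒Full (Separates-sym a∣b) (λ S′ S′⊂S → minimal S′ S′⊂S ∘ Separates-sym)

        x↛b : Reach π S x a → ¬ Reach π S x b
        x↛b x↝a x↝b = proj₂ (proj₂ a∣b) (Reach-trans (Reach-sym x↝a) x↝b)

    incomparableNeighbourhoods-⊥ : ∀ {C τ υ} → MinimalSeparator π S → IsComponent π S C →
      τ ∈ S → υ ∈ S → ¬ Adj π τ υ → ¬ NbhdIncl π C τ υ → ¬ NbhdIncl π C υ τ → ⊥
    incomparableNeighbourhoods-⊥ separator (_ , _ , C-connected , _) τ∈S υ∈S τ≁υ τ⊈υ υ⊈τ =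
      noPrivatePair id
      where
        open RawMonad ¬¬-Monad
        noPrivatePair : ¬ ¬ ⊥
        noPrivatePair = do
          x , x∈C , x-private ← ¬NbhdIncl⇒privateNeighbour τ⊈υ
          y , y∈C , y-private ← ¬NbhdIncl⇒privateNeighbour υ⊈τ
          d , x↛d , d-full ← minimalSeparator⇒fullComponentAvoiding separator x
          dτ ← d-full τ∈S
          dυ ← d-full υ∈S
          pure (privateNeighbours-⊥ τ≁υ x-private y-private (C-connected x∈C y∈C) x↛d dτ dυ)

open PermutationGraph using (NbhdIncl?; incomparableNeighbourhoods-⊥)

mainTheorem16 : ∀ {n} (π : Permutation n n) (S C : Subset n) →
    MinimalSeparator π S → IsComponent π S C →
    ∀ (τ υ : Fin n) → τ ∈ S → υ ∈ S → ¬ Adj π τ υ →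
    NbhdIncl π C τ υ ⊎ NbhdIncl π C υ τ
mainTheorem16 π S C separator component τ υ τ∈S υ∈S τ≁υ
  with NbhdIncl? π C τ υ | NbhdIncl? π C υ τ
... | yes τ⊆υ | _        = inj₁ τ⊆υ
... | no _    | yes υ⊆τ = inj₂ υ⊆τ
... | no τ⊈υ  | no υ⊈τ  = ⊥-elim (incomparableNeighbourhoods-⊥ π separator component τ∈S υ∈S τ≁υ τ⊈υ υ⊈τ)
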